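{- For every formula $X$ of LD: if $X$ is a theorem of LD, then $+X$ is a theorem of LD.
   Context: Logic LD. Atoms: classical atoms $a,b,\dots$ and alternate atoms $\underline a,\underline b,\dots$. Formulas: least set containing the atoms and closed under $\sim X$, $\neg X$, $X\supset Y$, $X\bullet Y$, $X\cup Y$, $X\equiv Y$. $+X$ abbreviates $\neg\sim X$. Alternate formulas $\underline X$: alternate atoms or formulas $\neg Y$. Axiom schemes: Ax1.1 $X\supset(Y\supset X)$; Ax1.2 $(X\supset(Y\supset Z))\supset((X\supset Y)\supset(X\supset Z))$; Ax1.3 $X\supset(X\cup Y)$; Ax1.4 $Y\supset(X\cup Y)$; Ax1.5 $(X\supset Z)\supset((Y\supset Z)\supset((X\cup Y)\supset Z))$; Ax1.6 $(X\bullet Y)\supset X$; Ax1.7 $(X\bullet Y)\supset Y$; Ax1.8 $(X\supset Y)\supset((X\supset Z)\supset(X\supset(Y\bullet Z)))$; Ax1.9 $X\supset(\sim X\supset Y)$; Ax1.10 $X\cup\sim X$; Ax1.11 $(X\equiv Y)\supset(X\supset Y)$; Ax1.12 $(X\equiv Y)\supset(Y\supset X)$; Ax1.13 $(X\supset Y)\supset((Y\supset X)\supset(X\equiv Y))$; Ax2.1 $(X\supset Y)\supset(+X\supset+Y)$; Ax2.2 $\neg X\supset\sim X$; Ax2.3 $\underline X\supset+\underline X$; Ax2.4 $+A$ for every instance $A$ of Ax1.1–Ax2.3. Only rule: modus ponens. Theorems: formulas derivable from the axioms by modus ponens. -}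

module Defs where

open import Data.Nat using (ℕ)

infixr 5 _⊃_
infixr 6 _∪_
infixr 7 _•_
infix 4 _≣_
data Formula : Set where
  cl  : ℕ → Formula
  alt : ℕ → Formula
  ∼_  : Formula → Formula
  ¬'_ : Formula → Formula
  _⊃_ : Formula → Formula → Formula
  _•_ : Formula → Formula → Formula
  _∪_ : Formula → Formula → Formula
  _≣_ : Formula → Formula → Formula

+_ : Formula → Formula
+ X = ¬' (∼ X)

data Alternate : Formula → Set where
  alt-atom : ∀ n → Alternate (alt n)
  alt-neg  : ∀ Y → Alternate (¬' Y)

data BaseAxiom : Formula → Set where
  ax1-1  : ∀ X Y → BaseAxiom (X ⊃ (Y ⊃ X))
  ax1-2  : ∀ X Y Z → BaseAxiom ((X ⊃ (Y ⊃ Z)) ⊃ ((X ⊃ Y) ⊃ (X ⊃ Z)))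
  ax1-3  : ∀ X Y → BaseAxiom (X ⊃ (X ∪ Y))
  ax1-4  : ∀ X Y → BaseAxiom (Y ⊃ (X ∪ Y))
  ax1-5  : ∀ X Y Z → BaseAxiom ((X ⊃ Z) ⊃ ((Y ⊃ Z) ⊃ ((X ∪ Y) ⊃ Z)))
  ax1-6  : ∀ X Y → BaseAxiom ((X • Y) ⊃ X)
  ax1-7  : ∀ X Y → BaseAxiom ((X • Y) ⊃ Y)
  ax1-8  : ∀ X Y Z → BaseAxiom ((X ⊃ Y) ⊃ ((X ⊃ Z) ⊃ (X ⊃ (Y • Z))))
  ax1-9  : ∀ X Y → BaseAxiom (X ⊃ ((∼ X) ⊃ Y))
  ax1-10 : ∀ X → BaseAxiom (X ∪ (∼ X))
  ax1-11 : ∀ X Y → BaseAxiom ((X ≣ Y) ⊃ (X ⊃ Y))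
  ax1-12 : ∀ X Y → BaseAxiom ((X ≣ Y) ⊃ (Y ⊃ X))
  ax1-13 : ∀ X Y → BaseAxiom ((X ⊃ Y) ⊃ ((Y ⊃ X) ⊃ (X ≣ Y)))
  ax2-1  : ∀ X Y → BaseAxiom ((X ⊃ Y) ⊃ ((+ X) ⊃ (+ Y)))
  ax2-2  : ∀ X → BaseAxiom ((¬' X) ⊃ (∼ X))
  ax2-3  : ∀ X → Alternate X → BaseAxiom (X ⊃ (+ X))

data Axiom : Formula → Set where
  base  : ∀ {A} → BaseAxiom A → Axiom A
  ax2-4 : ∀ {A} → BaseAxiom A → Axiom (+ A)

data Theorem : Formula → Set where
  axiom : ∀ {A} → Axiom A → Theorem A
  mp    : ∀ {X Y} → Theorem X → Theorem (X ⊃ Y) → Theorem Y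

{-# OPTIONS --safe #-}
module Submission where

open import Defs

-- Ax2.4 gives +A for base axioms; an Ax2.4 axiom +A is itself alternate, so
-- Ax2.3 yields ++A; and Ax2.1 lets + pass through modus ponens.

+-axiom : ∀ {A} → Axiom A → Theorem (+ A)
+-axiom (base a)      = axiom (ax2-4 a)
+-axiom (ax2-4 {A} a) = mp (axiom (ax2-4 a)) (axiom (base (ax2-3 (+ A) (alt-neg (∼ A)))))

+-mp : ∀ {X Y} → Theorem (X ⊃ Y) → Theorem (+ X) → Theorem (+ Y)
+-mp {X} {Y} X⊃Y +X = mp +X (mp X⊃Y (axiom (base (ax2-1 X Y))))

mainTheorem7 : ∀ (X : Formula) → Theorem X → Theorem (+ X)
mainTheorem7 _ (axiom a)      = +-axiom a
mainTheorem7 _ (mp {X} x x⊃y) = +-mp x⊃y (mainTheorem7 X x)
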